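{- For all integers $k,\ell\ge1$ and every orientation $\vec{P_k}$ of the path on $k$ vertices and every orientation $\vec{P_\ell}$ of the path on $\ell$ vertices, $\chi_o(\vec{P_k}\,\square\,\vec{P_\ell})\le 3$.
   Context: An oriented graph is a finite digraph with no loops, no multiple arcs and no pair of opposite arcs; an orientation of an undirected graph gives each edge one of its two directions. A homomorphism between oriented graphs is a vertex map sending arcs to arcs. The oriented chromatic number $\chi_o(\vec G)$ is the smallest order of an oriented graph $\vec T$ with a homomorphism $\vec G\to\vec T$. The Cartesian product $\vec G\,\square\,\vec H$ has vertex set $V(\vec G)\times V(\vec H)$, and $([u,v],[u',v'])$ is an arc iff either $u=u'$ and $(v,v')\in E(\vec H)$, or $v=v'$ and $(u,u')\in E(\vec G)$. -}

module Defs where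

open import Data.Nat using (ℕ; zero; suc; _≤_)
open import Data.Fin using (Fin; toℕ)
open import Data.Vec using (Vec; lookup)
open import Data.Bool using (Bool; true; false)
open import Data.Product using (Σ; _×_; _,_; ∃-syntax)
open import Data.Sum using (_⊎_)
open import Data.Empty using (⊥)
open import Relation.Nullary using (¬_)
open import Relation.Binary.PropositionalEquality using (_≡_)
open import Level using (0ℓ; suc)

-- A digraph on a vertex type V given by its arc relation.  Being a relation,
-- there are no multiple arcs by construction.
record OrientedGraph (V : Set) : Set₁ where
  field
    Arc      : V → V → Set
    noLoop   : ∀ v → ¬ Arc v v
    noOpp    : ∀ u v → Arc u v → ¬ Arc v u

open OrientedGraph public

Hom : {V W : Set} → OrientedGraph V → OrientedGraph W → Set
Hom {V} {W} G T = Σ (V → W) λ f → ∀ u v → Arc G u v → Arc T (f u) (f v)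

-- Orientations of the path on k vertices 0 - 1 - ... - (k-1):
-- a vector of k ∸ 1 booleans, entry i telling the direction of edge {i, i+1}
-- (true : i → i+1, false : i+1 → i).
PathOrientation : ℕ → Set
PathOrientation k = Vec Bool (Data.Nat._∸_ k 1)

data PathArc {k : ℕ} (d : PathOrientation k) : Fin k → Fin k → Set where
  fwd : ∀ (i : Fin (Data.Nat._∸_ k 1)) (u v : Fin k) →
        toℕ u ≡ toℕ i → toℕ v ≡ ℕ.suc (toℕ i) → lookup d i ≡ true → PathArc d u v
  bwd : ∀ (i : Fin (Data.Nat._∸_ k 1)) (u v : Fin k) →
        toℕ v ≡ toℕ i → toℕ u ≡ ℕ.suc (toℕ i) → lookup d i ≡ false → PathArc d u v

□Arc : {V W : Set} → (V → V → Set) → (W → W → Set) → V × W → V × W → Set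
□Arc A B (u , v) (u' , v') = (u ≡ u' × B v v') ⊎ (v ≡ v' × A u u')

χo≤ : {V : Set} → OrientedGraph V → ℕ → Set₁
χo≤ G m = ∃[ n ] (n ≤ m × Σ (OrientedGraph (Fin n)) λ T → Hom G T)

module Submission where

-- The directed triangle C₃ is an oriented graph of order 3, and a map φ into
-- ℤ/3 is a homomorphism to C₃ exactly when every arc u → v has φ v = φ u + 1.
-- An oriented path has such a "potential": walk along it, adding 1 across a
-- forward edge and subtracting 1 across a backward one.  For a Cartesian
-- product, the sum of potentials of the factors is a potential, since every
-- arc changes exactly one coordinate.

open import Defs
open import Data.Nat using (ℕ; zero; suc; _≤_)
open import Data.Nat.Properties using (≤-refl)
open import Data.Fin using (Fin; toℕ) renaming (zero to 0F; suc to sucF)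
open import Data.Vec using (Vec; lookup; []; _∷_)
open import Data.Bool using (Bool; true; false)
open import Data.Product using (_×_; _,_)
open import Data.Sum using (inj₁; inj₂)
open import Relation.Binary.PropositionalEquality using (_≡_; refl; subst)

pattern 1F = sucF 0F
pattern 2F = sucF 1F

suc₃ : Fin 3 → Fin 3
suc₃ 0F = 1F
suc₃ 1F = 2F
suc₃ 2F = 0F

pred₃ : Fin 3 → Fin 3
pred₃ 0F = 2F
pred₃ 1F = 0F
pred₃ 2F = 1F

suc₃∘pred₃ : ∀ a → a ≡ suc₃ (pred₃ a)
suc₃∘pred₃ 0F = refl
suc₃∘pred₃ 1F = refl
suc₃∘pred₃ 2F = refl

_+₃_ : Fin 3 → Fin 3 → Fin 3
0F +₃ b = b
1F +₃ b = suc₃ b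
2F +₃ b = suc₃ (suc₃ b)

+₃-sucʳ : ∀ a b → a +₃ suc₃ b ≡ suc₃ (a +₃ b)
+₃-sucʳ 0F b = refl
+₃-sucʳ 1F b = refl
+₃-sucʳ 2F b = refl

+₃-sucˡ : ∀ a b → suc₃ a +₃ b ≡ suc₃ (a +₃ b)
+₃-sucˡ 0F b = refl
+₃-sucˡ 1F b = refl
+₃-sucˡ 2F 0F = refl
+₃-sucˡ 2F 1F = refl
+₃-sucˡ 2F 2F = refl

C₃ : OrientedGraph (Fin 3)
C₃ = record { Arc = λ a b → b ≡ suc₃ a ; noLoop = noLoop₃ ; noOpp = noOpp₃ }
  where
  noLoop₃ : ∀ a → a ≡ suc₃ a → _
  noLoop₃ 0F ()
  noLoop₃ 1F ()
  noLoop₃ 2F ()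
  noOpp₃ : ∀ a b → b ≡ suc₃ a → a ≡ suc₃ b → _
  noOpp₃ 0F _ refl ()
  noOpp₃ 1F _ refl ()
  noOpp₃ 2F _ refl ()

IsC₃Potential : {V : Set} → (V → V → Set) → (V → Fin 3) → Set
IsC₃Potential A φ = ∀ u v → A u v → φ v ≡ suc₃ (φ u)

□-potential : {V W : Set} {A : V → V → Set} {B : W → W → Set}
  {φ : V → Fin 3} {ψ : W → Fin 3} →
  IsC₃Potential A φ → IsC₃Potential B ψ →
  IsC₃Potential (□Arc A B) (λ { (u , v) → φ u +₃ ψ v })
□-potential {φ = φ} {ψ} _ ψ-pot (u , v) (_ , v') (inj₁ (refl , a))
  rewrite ψ-pot v v' a = +₃-sucʳ (φ u) (ψ v)
□-potential {φ = φ} {ψ} φ-pot _ (u , v) (u' , _) (inj₂ (refl , a))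
  rewrite φ-pot u u' a = +₃-sucˡ (φ u) (ψ v)

-- Indexing by ℕ lets the potential be defined by recursion on the position;
-- the default value past the end of the vector is never used.
lookupℕ : ∀ {m} → Vec Bool m → ℕ → Bool
lookupℕ []      _       = true
lookupℕ (b ∷ _) zero    = b
lookupℕ (_ ∷ d) (suc n) = lookupℕ d n

lookupℕ-toℕ : ∀ {m} (d : Vec Bool m) (i : Fin m) → lookupℕ d (toℕ i) ≡ lookup d i
lookupℕ-toℕ (_ ∷ _) 0F       = refl
lookupℕ-toℕ (_ ∷ d) (sucF i) = lookupℕ-toℕ d i

stepAlong : Bool → Fin 3 → Fin 3
stepAlong true  = suc₃
stepAlong false = pred₃

pathPotential : ∀ {m} → Vec Bool m → ℕ → Fin 3
pathPotential d zero    = 0F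
pathPotential d (suc n) = stepAlong (lookupℕ d n) (pathPotential d n)

pathPotential-isC₃Potential : ∀ {k} (d : PathOrientation k) →
  IsC₃Potential (PathArc {k} d) (λ u → pathPotential d (toℕ u))
pathPotential-isC₃Potential d u v (fwd i .u .v u≡i v≡1+i d[i])
  rewrite u≡i | v≡1+i | lookupℕ-toℕ d i | d[i] = refl
pathPotential-isC₃Potential d u v (bwd i .u .v v≡i u≡1+i d[i])
  rewrite u≡1+i | v≡i | lookupℕ-toℕ d i | d[i] = suc₃∘pred₃ _

theorem11 : (k ℓ : ℕ) → 1 ≤ k → 1 ≤ ℓ →
    (P : PathOrientation k) (Q : PathOrientation ℓ) →
    (G : OrientedGraph (Fin k × Fin ℓ)) →
    Arc G ≡ □Arc (PathArc P) (PathArc Q) →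
    χo≤ G 3
theorem11 k ℓ _ _ P Q G Arc≡□ = 3 , ≤-refl , C₃ , colour , colour-hom
  where
  colour : Fin k × Fin ℓ → Fin 3
  colour (u , v) = pathPotential P (toℕ u) +₃ pathPotential Q (toℕ v)
  colour-potential : IsC₃Potential (□Arc (PathArc P) (PathArc Q)) colour
  colour-potential = □-potential (pathPotential-isC₃Potential P)
                                 (pathPotential-isC₃Potential Q)
  colour-hom : ∀ x y → Arc G x y → colour y ≡ suc₃ (colour x)
  colour-hom x y a = colour-potential x y (subst (λ R → R x y) Arc≡□ a)
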